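{- Let $m\ge2$, let $X$ and $f$ be the two-digit base-$m$ Kaprekar system, and let $t\ge1$ be an integer. There exists $x\in X$ with $T(x)=t$ if and only if there exists a positive divisor $d$ of $m+1$ such that $t$ is the smallest positive integer satisfying $d\mid 2^t+1$ or $d\mid 2^t-1$.
   Context: $X=\{0,1,\dots,m^2-1\}$, each element written with exactly two base-$m$ digits $x=d_1m+d_0$ (leading zeros allowed). The map is $f(x)=\big(m\max(d_0,d_1)+\min(d_0,d_1)\big)-\big(m\min(d_0,d_1)+\max(d_0,d_1)\big)$. Iterates: $f^0=\mathrm{id}$ and $f^t=f\circ f^{t-1}$. For $x\in X$: $S(x)$ is the least $s\ge0$ such that $f^{s+t'}(x)=f^s(x)$ for some $t'\ge1$. The minimal period $T(x)$ is the least $t'\ge1$ with $f^{S(x)+t'}(x)=f^{S(x)}(x)$. -}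

module Defs where

open import Data.Nat using (ℕ; zero; suc; _+_; _*_; _∸_; _^_; _≤_; _<_; _⊔_; _⊓_; NonZero)
open import Data.Nat.DivMod using (_/_; _%_)
open import Data.Nat.Divisibility using (_∣_)
open import Data.Product using (Σ; _×_; ∃)
open import Data.Sum using (_⊎_)
open import Relation.Binary.PropositionalEquality using (_≡_)

-- The two-digit base-m Kaprekar map on X = {0, …, m²-1}.
-- x = d₁ m + d₀ with d₁ = x / m, d₀ = x % m.
-- f(x) = (m·max + min) − (m·min + max); this is always ≥ 0 for m ≥ 1,
-- so truncated subtraction ∸ agrees with integer subtraction.
kap : (m : ℕ) → .{{NonZero m}} → ℕ → ℕ
kap m x =
  let d₁ = x / m
      d₀ = x % m
  in (m * (d₀ ⊔ d₁) + (d₀ ⊓ d₁)) ∸ (m * (d₀ ⊓ d₁) + (d₀ ⊔ d₁))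

iter : (ℕ → ℕ) → ℕ → ℕ → ℕ
iter f zero x = x
iter f (suc t) x = f (iter f t x)

IsLeast : (ℕ → Set) → ℕ → Set
IsLeast P n = P n × (∀ k → P k → n ≤ k)

Recurs : (ℕ → ℕ) → ℕ → ℕ → Set
Recurs f x s = ∃ λ t' → (1 ≤ t') × (iter f (s + t') x ≡ iter f s x)

IsPreperiod : (ℕ → ℕ) → ℕ → ℕ → Set
IsPreperiod f x s = IsLeast (Recurs f x) s

MinPeriod : (ℕ → ℕ) → ℕ → ℕ → Set
MinPeriod f x t = ∃ λ s → IsPreperiod f x s ×
  IsLeast (λ t' → (1 ≤ t') × (iter f (s + t') x ≡ iter f s x)) t

IsLeastOrder : ℕ → ℕ → Set
IsLeastOrder d t =
  IsLeast (λ u → (1 ≤ u) × ((d ∣ 2 ^ u + 1) ⊎ (d ∣ 2 ^ u ∸ 1))) t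

-- With x = d₁ m + d₀ the Kaprekar map is f x = (m − 1) |d₀ − d₁|, so from the first step on the
-- orbit consists of multiples (m − 1) y with y < m, on which f acts as y ↦ |2y − n| with n = m + 1:
-- up to sign, doubling modulo n. After a few steps y is 0 or has the same 2-adic valuation as n,
-- and two such residues that agree up to sign modulo n are equal. Hence f^t fixes (m − 1) y iff
-- 2^t y ≡ ±y (mod n), i.e. iff the additive order d = n / gcd n y of y divides 2^t + 1 or 2^t − 1.
-- Conversely every divisor d of n dividing some 2^t ± 1 is odd, and y = n / d is such a point.
module Submission where

open import Data.Empty using (⊥-elim)
open import Data.List using (_∷_; [])
open import Data.Nat
open import Data.Nat.Coprimality using (coprime-/gcd; coprime-divisor)
open import Data.Nat.Divisibility
open import Data.Nat.DivMod
open import Data.Nat.GCD using (gcd; gcd[m,n]∣m; gcd[m,n]∣n; gcd[m,n]≢0)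
open import Data.Nat.Induction using (<-rec)
open import Data.Nat.Properties
open import Data.Nat.Tactic.RingSolver using (solve)
open import Data.Product using (∃; ∃₂; _×_; _,_)
open import Data.Sum using (_⊎_; inj₁; inj₂; [_,_]′) renaming (map to ⊎-map)
open import Function.Bundles using (_⇔_; mk⇔; Equivalence)
open import Relation.Binary.PropositionalEquality
open import Relation.Nullary using (¬_)

open import Defs

open ≡-Reasoning

iter-+ : ∀ f a b x → iter f (a + b) x ≡ iter f a (iter f b x)
iter-+ f zero    b x = refl
iter-+ f (suc a) b x = cong f (iter-+ f a b x)

iter-preserves : ∀ {P : ℕ → Set} (f : ℕ → ℕ) → (∀ x → P x → P (f x)) →
                 ∀ j x → P x → P (iter f j x)
iter-preserves f pf zero    x px = px
iter-preserves f pf (suc j) x px = pf (iter f j x) (iter-preserves f pf j x px)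

iter-semiconj : ∀ {P : ℕ → Set} (f g h : ℕ → ℕ) → (∀ y → P y → P (g y)) →
                (∀ y → P y → f (h y) ≡ h (g y)) →
                ∀ j y → P y → iter f j (h y) ≡ h (iter g j y)
iter-semiconj f g h pg comm zero    y py = refl
iter-semiconj f g h pg comm (suc j) y py =
  trans (cong f (iter-semiconj f g h pg comm j y py))
        (comm (iter g j y) (iter-preserves g pg j y py))

iter-*-periodic : ∀ {f t z} → iter f t z ≡ z → ∀ c → iter f (t * c) z ≡ z
iter-*-periodic {f} {t} {z} per zero    = cong (λ j → iter f j z) (*-zeroʳ t)
iter-*-periodic {f} {t} {z} per (suc c) = begin
  iter f (t * suc c) z        ≡⟨ cong (λ j → iter f j z) (*-suc t c) ⟩
  iter f (t + t * c) z        ≡⟨ iter-+ f t (t * c) z ⟩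
  iter f t (iter f (t * c) z) ≡⟨ cong (iter f t) (iter-*-periodic {f} {t} per c) ⟩
  iter f t z                  ≡⟨ per ⟩
  z                           ∎

periodic⇒iter-preimage : ∀ {f t z} → 1 ≤ t → iter f t z ≡ z →
                         ∀ j → ∃ λ i → iter f j (iter f i z) ≡ z
periodic⇒iter-preimage {f} {suc t} {z} _ per j = suc t * j ∸ j , (begin
  iter f j (iter f (suc t * j ∸ j) z) ≡⟨ iter-+ f j (suc t * j ∸ j) z ⟨
  iter f (j + (suc t * j ∸ j)) z      ≡⟨ cong (λ i → iter f i z) (m+[n∸m]≡n (m≤n*m j (suc t))) ⟩
  iter f (suc t * j) z                ≡⟨ iter-*-periodic {f} {suc t} per j ⟩
  z                                   ∎)

Odd : ℕ → Set
Odd n = n % 2 ≡ 1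

even-or-odd : ∀ n → 2 ∣ n ⊎ Odd n
even-or-odd n with n % 2 in eq | m%n<n n 2
... | 0           | _               = inj₁ (m%n≡0⇒n∣m n 2 eq)
... | 1           | _               = inj₂ refl
... | suc (suc _) | s≤s (s≤s ())

odd⇒2∤ : ∀ {n} → Odd n → ¬ 2 ∣ n
odd⇒2∤ {n} odd 2∣n = 0≢1+n (trans (sym (n∣m⇒m%n≡0 n 2 2∣n)) odd)

odd-* : ∀ a b → Odd a → Odd b → Odd (a * b)
odd-* a b oa ob = trans (%-distribˡ-* a b 2) (cong₂ (λ x y → (x * y) % 2) oa ob)

odd+odd-even : ∀ a b → Odd a → Odd b → 2 ∣ a + b
odd+odd-even a b oa ob =
  m%n≡0⇒n∣m (a + b) 2 (trans (%-distribˡ-+ a b 2) (cong₂ (λ x y → (x + y) % 2) oa ob))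

even+odd-odd : ∀ {a b} → 2 ∣ a → Odd b → Odd (a + b)
even+odd-odd {a} {b} 2∣a ob = trans (%-remove-+ˡ b 2∣a) ob

odd⇒3≤ : ∀ {d} → 2 ≤ d → Odd d → 3 ≤ d
odd⇒3≤ {suc zero}          (s≤s ())    _
odd⇒3≤ {suc (suc zero)}    _           odd = ⊥-elim (odd⇒2∤ odd ∣-refl)
odd⇒3≤ {suc (suc (suc _))} _           _   = s≤s (s≤s (s≤s z≤n))

odd-∣-odd : ∀ {d n} → Odd n → d ∣ n → Odd d
odd-∣-odd {d} on d∣n with even-or-odd d
... | inj₁ 2∣d = ⊥-elim (odd⇒2∤ on (∣-trans 2∣d d∣n))
... | inj₂ od  = od

∣even-odd∣-odd : ∀ {a b} → 2 ∣ a → Odd b → Odd ∣ a - b ∣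
∣even-odd∣-odd {a} {b} 2∣a ob with even-or-odd ∣ a - b ∣ | ≤-total a b
... | inj₂ odd | _ = odd
... | inj₁ 2∣x | inj₁ a≤b =
  ⊥-elim (odd⇒2∤ ob (∣m∸n∣n⇒∣m 2 a≤b (subst (2 ∣_) (m≤n⇒∣m-n∣≡n∸m a≤b) 2∣x) 2∣a))
... | inj₁ 2∣x | inj₂ b≤a =
  ⊥-elim (odd⇒2∤ ob (∣m+n∣m⇒∣n (subst (2 ∣_) (sym (m∸n+n≡m b≤a)) 2∣a)
                                 (subst (2 ∣_) (m≤n⇒∣n-m∣≡n∸m b≤a) 2∣x)))

2∣m+m : ∀ m → 2 ∣ m + m
2∣m+m m = divides m (trans (cong (m +_) (sym (+-identityʳ m))) (*-comm 2 m))

odd-2^t+1 : ∀ {t} → 1 ≤ t → Odd (2 ^ t + 1)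
odd-2^t+1 {suc t} _ = even+odd-odd (m∣m*n (2 ^ t)) refl

odd-2^t∸1 : ∀ {t} → 1 ≤ t → Odd (2 ^ t ∸ 1)
odd-2^t∸1 {suc t} _ =
  subst Odd (m≤n⇒∣n-m∣≡n∸m (m^n>0 2 (suc t))) (∣even-odd∣-odd (m∣m*n (2 ^ t)) refl)

∣m∣n⇒∣∣m-n∣ : ∀ {d m n} → d ∣ m → d ∣ n → d ∣ ∣ m - n ∣
∣m∣n⇒∣∣m-n∣ {d} (divides p refl) (divides q refl) = divides ∣ p - q ∣ (sym (*-distribʳ-∣-∣ d p q))

2-adic-split : ∀ n → 0 < n → ∃₂ λ a q → Odd q × n ≡ 2 ^ a * q
2-adic-split = <-rec _ split
  where
  split : ∀ n → (∀ {h} → h < n → 0 < h → ∃₂ λ a q → Odd q × h ≡ 2 ^ a * q) →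
          0 < n → ∃₂ λ a q → Odd q × n ≡ 2 ^ a * q
  split n rec 0<n with even-or-odd n
  ... | inj₂ odd = 0 , n , odd , sym (+-identityʳ n)
  split .(zero * 2) rec () | inj₁ (divides zero refl)
  split .(suc h * 2) rec 0<n | inj₁ (divides (suc h) refl)
    with a , q , oq , h≡ ← rec (m<m*n (suc h) 2 (s≤s (s≤s z≤n))) z<s =
    suc a , q , oq , (begin
      suc h * 2       ≡⟨ cong (_* 2) h≡ ⟩
      2 ^ a * q * 2   ≡⟨ *-comm (2 ^ a * q) 2 ⟩
      2 * (2 ^ a * q) ≡⟨ *-assoc 2 (2 ^ a) q ⟨
      2 ^ suc a * q   ∎)

module SignedCongruence (n : ℕ) .{{_ : NonZero n}} where

  infix 4 _≡±_
  _≡±_ : ℕ → ℕ → Set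
  u ≡± v = u % n ≡ v % n ⊎ (u + v) % n ≡ 0

  %-congˡ-+ : ∀ {u v} w → u % n ≡ v % n → (u + w) % n ≡ (v + w) % n
  %-congˡ-+ {u} {v} w eq = begin
    (u + w) % n             ≡⟨ %-distribˡ-+ u w n ⟩
    (u % n + w % n) % n     ≡⟨ cong (λ z → (z + w % n) % n) eq ⟩
    (v % n + w % n) % n     ≡⟨ %-distribˡ-+ v w n ⟨
    (v + w) % n             ∎

  %≡%⇒∣∸ : ∀ u v → u % n ≡ v % n → n ∣ v ∸ u
  %≡%⇒∣∸ u v eq = divides (v / n ∸ u / n) (begin
    v ∸ u                                         ≡⟨ cong₂ _∸_ (m≡m%n+[m/n]*n v n) (m≡m%n+[m/n]*n u n) ⟩
    (v % n + v / n * n) ∸ (u % n + u / n * n)     ≡⟨ cong (λ z → (z + v / n * n) ∸ (u % n + u / n * n)) eq ⟨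
    (u % n + v / n * n) ∸ (u % n + u / n * n)     ≡⟨ [m+n]∸[m+o]≡n∸o (u % n) (v / n * n) (u / n * n) ⟩
    v / n * n ∸ u / n * n                         ≡⟨ *-distribʳ-∸ n (v / n) (u / n) ⟨
    (v / n ∸ u / n) * n                           ∎)

  ≡±-sym : ∀ {u v} → u ≡± v → v ≡± u
  ≡±-sym         (inj₁ eq) = inj₁ (sym eq)
  ≡±-sym {u} {v} (inj₂ eq) = inj₂ (trans (cong (_% n) (+-comm v u)) eq)

  ≡±-trans : ∀ {u v w} → u ≡± v → v ≡± w → u ≡± w
  ≡±-trans         (inj₁ p) (inj₁ q) = inj₁ (trans p q)
  ≡±-trans {w = w} (inj₁ p) (inj₂ q) = inj₂ (trans (%-congˡ-+ w p) q)
  ≡±-trans {u} {v} {w} (inj₂ p) (inj₁ q) = inj₂ (begin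
    (u + w) % n ≡⟨ cong (_% n) (+-comm u w) ⟩
    (w + u) % n ≡⟨ %-congˡ-+ u (sym q) ⟩
    (v + u) % n ≡⟨ cong (_% n) (+-comm v u) ⟩
    (u + v) % n ≡⟨ p ⟩
    0           ∎)
  ≡±-trans {u} {v} {w} (inj₂ p) (inj₂ q) = inj₁ (begin
    u % n           ≡⟨ %-remove-+ʳ u (m%n≡0⇒n∣m (v + w) n q) ⟨
    (u + (v + w)) % n ≡⟨ cong (_% n) (+-assoc u v w) ⟨
    (u + v + w) % n ≡⟨ %-remove-+ˡ w (m%n≡0⇒n∣m (u + v) n p) ⟩
    w % n           ∎)

  ≡±-*ˡ : ∀ c {u v} → u ≡± v → c * u ≡± c * v
  ≡±-*ˡ c {u} {v} (inj₁ eq) = inj₁ (begin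
    (c * u) % n             ≡⟨ %-distribˡ-* c u n ⟩
    (c % n * (u % n)) % n   ≡⟨ cong (λ z → (c % n * z) % n) eq ⟩
    (c % n * (v % n)) % n   ≡⟨ %-distribˡ-* c v n ⟨
    (c * v) % n             ∎)
  ≡±-*ˡ c {u} {v} (inj₂ eq) = inj₂ (n∣m⇒m%n≡0 _ n
    (subst (n ∣_) (*-distribˡ-+ c u v) (∣n⇒∣m*n c (m%n≡0⇒n∣m (u + v) n eq))))

  ∣m-n∣≡±m : ∀ u → ∣ u - n ∣ ≡± u
  ∣m-n∣≡±m u with ≤-total n u
  ... | inj₁ n≤u = inj₁ (begin
    ∣ u - n ∣ % n   ≡⟨ cong (_% n) (m≤n⇒∣n-m∣≡n∸m n≤u) ⟩
    (u ∸ n) % n     ≡⟨ [m+n]%n≡m%n (u ∸ n) n ⟨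
    (u ∸ n + n) % n ≡⟨ cong (_% n) (m∸n+n≡m n≤u) ⟩
    u % n           ∎)
  ... | inj₂ u≤n = inj₂ (begin
    (∣ u - n ∣ + u) % n ≡⟨ cong (λ z → (z + u) % n) (m≤n⇒∣m-n∣≡n∸m u≤n) ⟩
    (n ∸ u + u) % n     ≡⟨ cong (_% n) (m∸n+n≡m u≤n) ⟩
    n % n               ≡⟨ n%n≡0 n ⟩
    0                   ∎)

  -- The hypothesis 1 ≤ c makes c * y = y + y * (c ∸ 1) hold despite truncated subtraction.
  *y≡±y⇔∣ : ∀ {c} y → 1 ≤ c → c * y ≡± y ⇔ (n ∣ y * (c + 1) ⊎ n ∣ y * (c ∸ 1))
  *y≡±y⇔∣ {c} y 1≤c = mk⇔ to from
    where
    c*y≡y+y*[c∸1] : c * y ≡ y + y * (c ∸ 1)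
    c*y≡y+y*[c∸1] = begin
      c * y                ≡⟨ *-comm c y ⟩
      y * c                ≡⟨ cong (y *_) (m+[n∸m]≡n 1≤c) ⟨
      y * (1 + (c ∸ 1))    ≡⟨ *-distribˡ-+ y 1 (c ∸ 1) ⟩
      y * 1 + y * (c ∸ 1)  ≡⟨ cong (_+ y * (c ∸ 1)) (*-identityʳ y) ⟩
      y + y * (c ∸ 1)      ∎
    c*y+y≡y*[c+1] : c * y + y ≡ y * (c + 1)
    c*y+y≡y*[c+1] = solve (c ∷ y ∷ [])
    to : c * y ≡± y → n ∣ y * (c + 1) ⊎ n ∣ y * (c ∸ 1)
    to (inj₁ eq) = inj₂ (subst (n ∣_) (trans (cong (_∸ y) c*y≡y+y*[c∸1]) (m+n∸m≡n y _))
                                      (%≡%⇒∣∸ y (c * y) (sym eq)))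
    to (inj₂ eq) = inj₁ (subst (n ∣_) c*y+y≡y*[c+1] (m%n≡0⇒n∣m _ n eq))
    from : n ∣ y * (c + 1) ⊎ n ∣ y * (c ∸ 1) → c * y ≡± y
    from (inj₁ n∣) = inj₂ (n∣m⇒m%n≡0 _ n (subst (n ∣_) (sym c*y+y≡y*[c+1]) n∣))
    from (inj₂ n∣) = inj₁ (trans (cong (_% n) c*y≡y+y*[c∸1]) (%-remove-+ʳ y n∣))

-- The Kaprekar map for base m, read on multiples of m − 1 (see kap-*pred), is tent (m + 1).
tent : ℕ → ℕ → ℕ
tent n zero      = zero
tent n y@(suc _) = ∣ y + y - n ∣

-- y = 0, or y and n have the same 2-adic valuation.
Aligned : ℕ → ℕ → Set
Aligned n y = y ≡ 0 ⊎ ∃₂ λ p r → Odd p × Odd r × p * y ≡ r * n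

AdditiveOrder : ℕ → ℕ → ℕ → Set
AdditiveOrder n y d = ∀ W → n ∣ y * W ⇔ d ∣ W

infix 4 _∣2^_±1
_∣2^_±1 : ℕ → ℕ → Set
d ∣2^ t ±1 = d ∣ 2 ^ t + 1 ⊎ d ∣ 2 ^ t ∸ 1

*-∣y+y-n∣ : ∀ n p r y → p * y ≡ r * n → p * ∣ y + y - n ∣ ≡ ∣ r + r - p ∣ * n
*-∣y+y-n∣ n p r y eq = begin
  p * ∣ y + y - n ∣        ≡⟨ *-distribˡ-∣-∣ p (y + y) n ⟩
  ∣ p * (y + y) - p * n ∣  ≡⟨ cong (λ z → ∣ z - p * n ∣) p*[y+y]≡[r+r]*n ⟩
  ∣ (r + r) * n - p * n ∣  ≡⟨ *-distribʳ-∣-∣ n (r + r) p ⟨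
  ∣ r + r - p ∣ * n        ∎
  where
  p*[y+y]≡[r+r]*n : p * (y + y) ≡ (r + r) * n
  p*[y+y]≡[r+r]*n = trans (*-distribˡ-+ p y y) (trans (cong₂ _+_ eq eq) (sym (*-distribʳ-+ n r r)))

tent-aligned : ∀ {n} p r y → Odd p → p * y ≡ r * n → Aligned n (tent n y)
tent-aligned     p r zero    _  _  = inj₁ refl
tent-aligned {n} p r (suc y) op eq =
  inj₂ (p , ∣ r + r - p ∣ , op , ∣even-odd∣-odd (2∣m+m r) op , *-∣y+y-n∣ n p r (suc y) eq)

aligned-tent : ∀ {n} y → Aligned n y → Aligned n (tent n y)
aligned-tent y (inj₁ refl)                 = inj₁ refl
aligned-tent y (inj₂ (p , r , op , _ , eq)) = tent-aligned p r y op eq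

∣-tent : ∀ {d n} y → d ∣ y + y → d ∣ n → d ∣ tent n y
∣-tent {d} zero    _ _   = d ∣0
∣-tent     (suc y) h d∣n = ∣m∣n⇒∣∣m-n∣ h d∣n

tent-< : ∀ {n y} → y < n → tent n y < n
tent-< {n} {zero}  lt = lt
tent-< {n} {suc y} lt with ≤-total n (suc y + suc y)
... | inj₁ n≤2y = subst (_< n) (sym (m≤n⇒∣n-m∣≡n∸m n≤2y))
                        (m<n+o⇒m∸n<o (suc y + suc y) n {{>-nonZero (≤-<-trans z≤n lt)}} (+-mono-< lt lt))
... | inj₂ 2y≤n = subst (_< n) (sym (m≤n⇒∣m-n∣≡n∸m 2y≤n))
                        (∸-monoʳ-< {o = 0} z<s 2y≤n)

aligned-sum≢ : ∀ {n u v} → Aligned n u → Aligned n v → u < n → v < n → u + v ≢ n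
aligned-sum≢ (inj₁ refl) _           _   v<n eq = <-irrefl eq v<n
aligned-sum≢ (inj₂ _)    (inj₁ refl) u<n _   eq = <-irrefl (trans (sym (+-identityʳ _)) eq) u<n
aligned-sum≢ {n} {u} {v} (inj₂ (p , r , op , or , pu≡rn)) (inj₂ (p′ , r′ , op′ , or′ , p′v≡r′n)) u<n _ u+v≡n =
  odd⇒2∤ (odd-* p p′ op op′)
    (subst (2 ∣_) (sym pp′≡) (odd+odd-even (p′ * r) (p * r′) (odd-* p′ r op′ or) (odd-* p r′ op or′)))
  where
  instance
    _ : NonZero n
    _ = >-nonZero (≤-<-trans z≤n u<n)
  distribute : ∀ p p′ u v → p * p′ * (u + v) ≡ p′ * (p * u) + p * (p′ * v)
  distribute = λ p p′ u v → solve (p ∷ p′ ∷ u ∷ v ∷ [])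
  collect : ∀ p p′ r r′ n → p′ * (r * n) + p * (r′ * n) ≡ (p′ * r + p * r′) * n
  collect = λ p p′ r r′ n → solve (p ∷ p′ ∷ r ∷ r′ ∷ n ∷ [])
  pp′≡ : p * p′ ≡ p′ * r + p * r′
  pp′≡ = *-cancelʳ-≡ _ _ n (begin
    p * p′ * n                      ≡⟨ cong (p * p′ *_) u+v≡n ⟨
    p * p′ * (u + v)                ≡⟨ distribute p p′ u v ⟩
    p′ * (p * u) + p * (p′ * v)     ≡⟨ cong₂ (λ x y → p′ * x + p * y) pu≡rn p′v≡r′n ⟩
    p′ * (r * n) + p * (r′ * n)     ≡⟨ collect p p′ r r′ n ⟩
    (p′ * r + p * r′) * n           ∎)

module TentDynamics (n : ℕ) .{{_ : NonZero n}} where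

  open SignedCongruence n

  tent-≡±-2* : ∀ y → tent n y ≡± 2 * y
  tent-≡±-2* zero        = inj₁ refl
  tent-≡±-2* y@(suc _) =
    subst (∣ y + y - n ∣ ≡±_) (cong (y +_) (sym (+-identityʳ y))) (∣m-n∣≡±m (y + y))

  iter-tent-≡± : ∀ j y → iter (tent n) j y ≡± 2 ^ j * y
  iter-tent-≡± zero    y = inj₁ (cong (_% n) (sym (*-identityˡ y)))
  iter-tent-≡± (suc j) y =
    ≡±-trans (tent-≡±-2* (iter (tent n) j y))
             (subst (2 * iter (tent n) j y ≡±_) (sym (*-assoc 2 (2 ^ j) y))
                    (≡±-*ˡ 2 (iter-tent-≡± j y)))

  iter-tent-< : ∀ j {y} → y < n → iter (tent n) j y < n
  iter-tent-< j {y} = iter-preserves (tent n) (λ x → tent-< {n} {x}) j y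

  iter-aligned : ∀ j {y} → Aligned n y → Aligned n (iter (tent n) j y)
  iter-aligned j {y} = iter-preserves (tent n) aligned-tent j y

  aligned-≡±⇒≡ : ∀ {u v} → u < n → v < n → Aligned n u → Aligned n v → u ≡± v → u ≡ v
  aligned-≡±⇒≡ u<n v<n _ _ (inj₁ eq) =
    trans (sym (m<n⇒m%n≡m u<n)) (trans eq (m<n⇒m%n≡m v<n))
  aligned-≡±⇒≡ {u} {v} u<n v<n au av (inj₂ eq) with m%n≡0⇒n∣m (u + v) n eq
  ... | divides zero          u+v≡0 = trans (m+n≡0⇒m≡0 u u+v≡0) (sym (m+n≡0⇒n≡0 u u+v≡0))
  ... | divides (suc zero)    u+v≡n = ⊥-elim (aligned-sum≢ au av u<n v<n (trans u+v≡n (+-identityʳ n)))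
  ... | divides (suc (suc c)) u+v≡ = ⊥-elim (<⇒≱ (+-mono-< u<n v<n)
        (≤-trans (+-monoʳ-≤ n (m≤m+n n (c * n))) (≤-reflexive (sym u+v≡))))

  iter-tent-fixed⇔ : ∀ t {y} → y < n → Aligned n y →
                     iter (tent n) t y ≡ y ⇔ (n ∣ y * (2 ^ t + 1) ⊎ n ∣ y * (2 ^ t ∸ 1))
  iter-tent-fixed⇔ t {y} y<n ay = mk⇔
    (λ fixed → Equivalence.to (*y≡±y⇔∣ y (m^n>0 2 t))
                 (≡±-sym (subst (_≡± 2 ^ t * y) fixed (iter-tent-≡± t y))))
    (λ n∣ → aligned-≡±⇒≡ (iter-tent-< t y<n) y<n (iter-aligned t ay) ay
                 (≡±-trans (iter-tent-≡± t y) (Equivalence.from (*y≡±y⇔∣ y (m^n>0 2 t)) n∣)))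

  iter-tent-fixed⇔order : ∀ t {y d} → y < n → Aligned n y → AdditiveOrder n y d →
                          iter (tent n) t y ≡ y ⇔ d ∣2^ t ±1
  iter-tent-fixed⇔order t y<n ay order = mk⇔
    (λ fixed → ⊎-map (Equivalence.to (order _)) (Equivalence.to (order _))
                     (Equivalence.to (iter-tent-fixed⇔ t y<n ay) fixed))
    (λ d∣ → Equivalence.from (iter-tent-fixed⇔ t y<n ay)
              (⊎-map (Equivalence.from (order _)) (Equivalence.from (order _)) d∣))

  -- After j ≤ a steps the orbit is divisible by 2 ^ j; one more step makes it aligned.
  module _ {a q : ℕ} (odd-q : Odd q) (n≡ : n ≡ 2 ^ a * q) where

    2^j∣n : ∀ {j} → j ≤ a → 2 ^ j ∣ n
    2^j∣n {j} j≤a = subst (2 ^ j ∣_) (sym n≡) (∣m⇒∣m*n q (divides (2 ^ (a ∸ j)) (begin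
      2 ^ a               ≡⟨ cong (2 ^_) (m+[n∸m]≡n j≤a) ⟨
      2 ^ (j + (a ∸ j))   ≡⟨ ^-distribˡ-+-* 2 j (a ∸ j) ⟩
      2 ^ j * 2 ^ (a ∸ j) ≡⟨ *-comm (2 ^ j) _ ⟩
      2 ^ (a ∸ j) * 2 ^ j ∎)))

    2^j∣iter-tent : ∀ j y → j ≤ a → 2 ^ j ∣ iter (tent n) j y
    2^j∣iter-tent zero    y _   = 1∣ y
    2^j∣iter-tent (suc j) y j<a = ∣-tent w
      (subst (2 ^ suc j ∣_) (cong (w +_) (+-identityʳ w)) (*-monoʳ-∣ 2 (2^j∣iter-tent j y (<⇒≤ j<a))))
      (2^j∣n j<a)
      where w = iter (tent n) j y

    aligned-eventually : ∀ c y → Aligned n (iter (tent n) (c + suc a) y)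
    aligned-eventually c y with 2^j∣iter-tent a y ≤-refl
    ... | divides z w≡z*2^a = subst (Aligned n) (sym (iter-+ (tent n) c (suc a) y))
      (iter-aligned c (tent-aligned q z w odd-q (begin
        q * w             ≡⟨ cong (q *_) w≡z*2^a ⟩
        q * (z * 2 ^ a)   ≡⟨ *-comm q (z * 2 ^ a) ⟩
        z * 2 ^ a * q     ≡⟨ *-assoc z (2 ^ a) q ⟩
        z * (2 ^ a * q)   ≡⟨ cong (z *_) n≡ ⟨
        z * n             ∎)))
      where w = iter (tent n) a y

additiveOrder-zero : ∀ n → AdditiveOrder n 0 1
additiveOrder-zero n W = mk⇔ (λ _ → 1∣ W) (λ _ → n ∣0)

additiveOrder-cofactor : ∀ {n d e} .{{_ : NonZero e}} → n ≡ e * d → AdditiveOrder n e d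
additiveOrder-cofactor {e = e} n≡e*d W = mk⇔
  (λ n∣ → *-cancelˡ-∣ e (subst (_∣ e * W) n≡e*d n∣))
  (λ d∣ → subst (_∣ e * W) (sym n≡e*d) (*-monoʳ-∣ e d∣))

additiveOrder-exists : ∀ n y .{{_ : NonZero n}} → ∃ λ d → 1 ≤ d × d ∣ n × AdditiveOrder n y d
additiveOrder-exists n y = n / g , 1≤d , m/n∣m g∣n , λ W → mk⇔ (to W) (from W)
  where
  g = gcd n y
  instance
    _ : NonZero g
    _ = ≢-nonZero (gcd[m,n]≢0 n y (inj₁ (≢-nonZero⁻¹ n)))
  g∣n : g ∣ n
  g∣n = gcd[m,n]∣m n y
  g*d≡n : g * (n / g) ≡ n
  g*d≡n = m*[n/m]≡n g∣n
  g*e≡y : g * (y / g) ≡ y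
  g*e≡y = m*[n/m]≡n (gcd[m,n]∣n n y)
  g*[e*W]≡y*W : ∀ W → g * (y / g * W) ≡ y * W
  g*[e*W]≡y*W W = trans (sym (*-assoc g (y / g) W)) (cong (_* W) g*e≡y)
  to : ∀ W → n ∣ y * W → n / g ∣ W
  to W n∣ = coprime-divisor (coprime-/gcd n y)
              (*-cancelˡ-∣ g (subst₂ _∣_ (sym g*d≡n) (sym (g*[e*W]≡y*W W)) n∣))
  from : ∀ W → n / g ∣ W → n ∣ y * W
  from W d∣ = subst₂ _∣_ g*d≡n (g*[e*W]≡y*W W) (*-monoʳ-∣ g (∣n⇒∣m*n (y / g) d∣))
  1≤d : 1 ≤ n / g
  1≤d = n≢0⇒n>0 λ d≡0 → ≢-nonZero⁻¹ n (trans (sym g*d≡n) (trans (cong (g *_) d≡0) (*-zeroʳ g)))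

⊔≡⊓+∣-∣ : ∀ a b → a ⊔ b ≡ a ⊓ b + ∣ a - b ∣
⊔≡⊓+∣-∣ zero    zero    = refl
⊔≡⊓+∣-∣ zero    (suc b) = refl
⊔≡⊓+∣-∣ (suc a) zero    = refl
⊔≡⊓+∣-∣ (suc a) (suc b) = cong suc (⊔≡⊓+∣-∣ a b)

digitGap : (m : ℕ) .{{_ : NonZero m}} → ℕ → ℕ
digitGap m x = ∣ x % m - x / m ∣

kap≡*digitGap : ∀ m′ x → kap (suc m′) x ≡ m′ * digitGap (suc m′) x
kap≡*digitGap m′ x = begin
  kap m x                                       ≡⟨ cong (λ z → (m * z + L) ∸ (m * L + z)) (⊔≡⊓+∣-∣ a b) ⟩
  (m * (L + δ) + L) ∸ (m * L + (L + δ))         ≡⟨ cong (_∸ (m * L + (L + δ))) (rearrange m′ L δ) ⟩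
  (m * L + (L + δ)) + m′ * δ ∸ (m * L + (L + δ)) ≡⟨ m+n∸m≡n (m * L + (L + δ)) (m′ * δ) ⟩
  m′ * δ                                        ∎
  where
  m = suc m′
  a = x % m
  b = x / m
  L = a ⊓ b
  δ = ∣ a - b ∣
  rearrange : ∀ m′ L δ → suc m′ * (L + δ) + L ≡ (suc m′ * L + (L + δ)) + m′ * δ
  rearrange = λ m′ L δ → solve (m′ ∷ L ∷ δ ∷ [])

digitGap-*pred : ∀ m′ y → y < suc m′ → digitGap (suc m′) (m′ * y) ≡ tent (suc (suc m′)) y
digitGap-*pred m′ zero    _          rewrite *-zeroʳ m′ = refl
digitGap-*pred m′ (suc j) (s≤s j<m′) with m≤n⇒∃[o]m+o≡n j<m′
... | i , refl = begin
  digitGap M (suc (j + i) * suc j)  ≡⟨ cong (digitGap M) (digits j i) ⟩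
  ∣ X % M - X / M ∣                 ≡⟨ cong₂ ∣_-_∣ X%M≡1+i X/M≡j ⟩
  ∣ suc i - j ∣                     ≡⟨ ∣-∣-comm (suc i) j ⟩
  ∣ j - suc i ∣                     ≡⟨ ∣m+n-m+o∣≡∣n-o∣ j (suc j) (suc (suc i)) ⟨
  ∣ j + suc j - j + suc (suc i) ∣   ≡⟨ cong (λ z → ∣ j + suc j - z ∣) (trans (+-suc j (suc i)) (cong suc (+-suc j i))) ⟩
  tent (suc M) (suc j)              ∎
  where
  M = suc (suc (j + i))
  X = suc i + j * M
  digits : ∀ j i → suc (j + i) * suc j ≡ suc i + j * suc (suc (j + i))
  digits = λ j i → solve (j ∷ i ∷ [])
  1+i<M : suc i < M
  1+i<M = s≤s (s≤s (m≤n+m i j))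
  X%M≡1+i : X % M ≡ suc i
  X%M≡1+i = trans ([m+kn]%n≡m%n (suc i) j M) (m<n⇒m%n≡m 1+i<M)
  X/M≡j : X / M ≡ j
  X/M≡j = trans (+-distrib-/-∣ʳ (suc i) (n∣m*n j)) (cong₂ _+_ (m<n⇒m/n≡0 1+i<M) (m*n/n≡m j M))

2+e≤e*d : ∀ {d e} → 3 ≤ d → 1 ≤ e → 2 + e ≤ e * d
2+e≤e*d {d} {e} 3≤d 1≤e =
  ≤-trans (+-monoˡ-≤ e (*-monoʳ-≤ 2 1≤e))
  (≤-trans (≤-reflexive (+-comm (2 * e) e))
  (≤-trans (*-monoˡ-≤ e 3≤d) (≤-reflexive (*-comm d e))))

module Kaprekar (m′ : ℕ) .{{_ : NonZero m′}} where

  m n : ℕ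
  m = suc m′
  n = suc m

  open TentDynamics n

  digitGap-< : ∀ {x} → x < m * m → digitGap m x < m
  digitGap-< {x} x<m*m =
    ≤-trans (s≤s (∣m-n∣≤m⊔n (x % m) (x / m))) (⊔-lub (m%n<n x m) (m<n*o⇒m/o<n x<m*m))

  *pred-< : ∀ {y} → y < m → m′ * y < m * m
  *pred-< y<m = ≤-<-trans (*-monoʳ-≤ m′ (≤-pred y<m)) (*-mono-< (n<1+n m′) (n<1+n m′))

  kap-< : ∀ {x} → x < m * m → kap m x < m * m
  kap-< {x} x<m*m = subst (_< m * m) (sym (kap≡*digitGap m′ x)) (*pred-< (digitGap-< x<m*m))

  tent-<m : ∀ {y} → y < m → tent n y < m
  tent-<m {y} y<m = subst (_< m) (digitGap-*pred m′ y y<m) (digitGap-< (*pred-< y<m))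

  kap-*pred : ∀ y → y < m → kap m (m′ * y) ≡ m′ * tent n y
  kap-*pred y y<m = trans (kap≡*digitGap m′ (m′ * y)) (cong (m′ *_) (digitGap-*pred m′ y y<m))

  iter-kap-*pred : ∀ j y → y < m → iter (kap m) j (m′ * y) ≡ m′ * iter (tent n) j y
  iter-kap-*pred = iter-semiconj (kap m) (tent n) (m′ *_) (λ y → tent-<m {y}) kap-*pred

  iter-kap-suc : ∀ j {x} → x < m * m → iter (kap m) (suc j) x ≡ m′ * iter (tent n) j (digitGap m x)
  iter-kap-suc j {x} x<m*m = begin
    iter (kap m) (suc j) x               ≡⟨ cong (λ i → iter (kap m) i x) (+-comm 1 j) ⟩
    iter (kap m) (j + 1) x               ≡⟨ iter-+ (kap m) j 1 x ⟩
    iter (kap m) j (kap m x)             ≡⟨ cong (iter (kap m) j) (kap≡*digitGap m′ x) ⟩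
    iter (kap m) j (m′ * digitGap m x)   ≡⟨ iter-kap-*pred j _ (digitGap-< x<m*m) ⟩
    m′ * iter (tent n) j (digitGap m x)  ∎

  iter-kap-fixed⇔order : ∀ t {y d} → y < m → Aligned n y → AdditiveOrder n y d →
                         iter (kap m) t (m′ * y) ≡ m′ * y ⇔ d ∣2^ t ±1
  iter-kap-fixed⇔order t {y} y<m ay order = mk⇔
    (λ fixed → Equivalence.to tent-criterion
                 (*-cancelˡ-≡ _ _ m′ (trans (sym (iter-kap-*pred t y y<m)) fixed)))
    (λ d∣ → trans (iter-kap-*pred t y y<m) (cong (m′ *_) (Equivalence.from tent-criterion d∣)))
    where
    tent-criterion = iter-tent-fixed⇔order t (m≤n⇒m≤1+n y<m) ay order

  periodic-point-aligned : ∀ {t z} → z < m * m → 1 ≤ t → iter (kap m) t z ≡ z →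
                           ∃ λ y → y < m × Aligned n y × z ≡ m′ * y
  periodic-point-aligned {t} {z} z<m*m 1≤t periodic
    with a , q , odd-q , n≡ ← 2-adic-split n z<s
    with i , preimage ← periodic⇒iter-preimage 1≤t periodic (suc (suc a)) =
    y , y<m , aligned-eventually {a} {q} odd-q n≡ 0 (digitGap m w) ,
    trans (sym preimage) (iter-kap-suc (suc a) w<m*m)
    where
    w = iter (kap m) i z
    w<m*m : w < m * m
    w<m*m = iter-preserves (kap m) (λ x → kap-< {x}) i z z<m*m
    y = iter (tent n) (suc a) (digitGap m w)
    y<m : y < m
    y<m = iter-preserves (tent n) (λ y → tent-<m {y}) (suc a) (digitGap m w) (digitGap-< w<m*m)

  divisor-point : ∀ {d t} → 1 ≤ d → d ∣ n → 1 ≤ t → d ∣2^ t ±1 →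
                  ∃ λ y → y < m × Aligned n y × AdditiveOrder n y d
  divisor-point {suc zero} _ _ _ _ = 0 , z<s , inj₁ refl , additiveOrder-zero n
  divisor-point {d@(suc (suc _))} _ (divides (suc e′) n≡e*d) 1≤t d∣ =
    e , ≤-pred (subst (2 + e ≤_) (sym n≡e*d) (2+e≤e*d (odd⇒3≤ (s≤s (s≤s z≤n)) odd-d) (s≤s z≤n))) ,
    inj₂ (d , 1 , odd-d , refl , d*e≡1*n) , additiveOrder-cofactor {e = e} n≡e*d
    where
    e = suc e′
    odd-d : Odd d
    odd-d = [ odd-∣-odd (odd-2^t+1 1≤t) , odd-∣-odd (odd-2^t∸1 1≤t) ]′ d∣
    d*e≡1*n : d * e ≡ 1 * n
    d*e≡1*n = trans (*-comm d e) (trans (sym n≡e*d) (sym (+-identityʳ n)))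

  exactPeriod⇒order : ∀ {z t} → z < m * m → 1 ≤ t → iter (kap m) t z ≡ z →
                      (∀ u → 1 ≤ u → iter (kap m) u z ≡ z → t ≤ u) →
                      ∃ λ d → 1 ≤ d × d ∣ n × IsLeastOrder d t
  exactPeriod⇒order {z} {t} z<m*m 1≤t periodic least
    with y , y<m , ay , z≡m′y ← periodic-point-aligned z<m*m 1≤t periodic
    with d , 1≤d , d∣n , order ← additiveOrder-exists n y =
    d , 1≤d , d∣n , (1≤t , Equivalence.to (criterion t) periodic) ,
    λ u (1≤u , d∣u) → least u 1≤u (Equivalence.from (criterion u) d∣u)
    where
    criterion : ∀ u → iter (kap m) u z ≡ z ⇔ d ∣2^ u ±1
    criterion u = subst (λ v → iter (kap m) u v ≡ v ⇔ d ∣2^ u ±1) (sym z≡m′y)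
                        (iter-kap-fixed⇔order u y<m ay order)

  toOrder : ∀ t → (∃ λ x → x < m * m × MinPeriod (kap m) x t) →
            ∃ λ d → 1 ≤ d × d ∣ n × IsLeastOrder d t
  toOrder t (x , x<m*m , s , _ , ((1≤t , periodic) , least)) =
    exactPeriod⇒order (iter-preserves (kap m) (λ x → kap-< {x}) s x x<m*m) 1≤t
      (trans (sym (shift t)) periodic) (λ u 1≤u fixed → least u (1≤u , trans (shift u) fixed))
    where
    shift : ∀ u → iter (kap m) (s + u) x ≡ iter (kap m) u (iter (kap m) s x)
    shift u = trans (cong (λ i → iter (kap m) i x) (+-comm s u)) (iter-+ (kap m) u s x)

  fromOrder : ∀ t → 1 ≤ t → (∃ λ d → 1 ≤ d × d ∣ n × IsLeastOrder d t) →
              ∃ λ x → x < m * m × MinPeriod (kap m) x t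
  fromOrder t 1≤t (d , 1≤d , d∣n , (_ , d∣t) , least)
    with y , y<m , ay , order ← divisor-point 1≤d d∣n 1≤t d∣t =
    m′ * y , *pred-< y<m , 0 , ((t , 1≤t , fixed t d∣t) , λ _ _ → z≤n) ,
    (1≤t , fixed t d∣t) , λ u (1≤u , fixed-u) → least u (1≤u , Equivalence.to (criterion u) fixed-u)
    where
    criterion : ∀ u → iter (kap m) u (m′ * y) ≡ m′ * y ⇔ d ∣2^ u ±1
    criterion u = iter-kap-fixed⇔order u y<m ay order
    fixed : ∀ u → d ∣2^ u ±1 → iter (kap m) u (m′ * y) ≡ m′ * y
    fixed u = Equivalence.from (criterion u)

theorem3p3p3 : (m : ℕ) → .{{_ : NonZero m}} → 2 ≤ m → (t : ℕ) → 1 ≤ t →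
    (∃ λ x → (x < m * m) × MinPeriod (kap m) x t)
    ⇔ (∃ λ d → (1 ≤ d) × (d ∣ suc m) × IsLeastOrder d t)
theorem3p3p3 (suc zero)    (s≤s ())
theorem3p3p3 (suc (suc k)) _ t 1≤t =
  mk⇔ (Kaprekar.toOrder (suc k) t) (Kaprekar.fromOrder (suc k) t 1≤t)
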